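{- Let $\overline{m}_o(n)$ denote the number of overpartitions $\pi$ of $n$ into odd parts such that no positive integer less than $\mathrm{omoex}(\pi)$ appears as an overlined part of $\pi$, and let $\overline{M}_o(q)=\sum_{n\ge 0}\overline{m}_o(n)q^n$. Then $$\overline{M}_o(q)=\overline{P}_o(q)\bigl(1-F(-q)\bigr),$$ where $\overline{P}_o(q)=\dfrac{(-q;q^2)_\infty}{(q;q^2)_\infty}$ and $$F(q)=\sum_{n=1}^{\infty}\frac{(-1)^n q^{n^2}}{(q;q^2)_n}.$$
   Context: For $|q|<1$, $(a;q)_L=\prod_{k=0}^{L-1}(1-aq^k)$ and $(a;q)_\infty=\lim_{L\to\infty}(a;q)_L$. An overpartition of $n$ is a partition of $n$ in which the first occurrence of each distinct part size may (or may not) be overlined; an overpartition into odd parts is one in which all parts are odd. For an overpartition $\pi$ into odd parts, $\mathrm{omoex}(\pi)$ is the smallest positive odd integer that does not occur as a part of $\pi$, whether overlined or non-overlined. The empty overpartition is the unique overpartition of $0$. The identity is an identity of formal power series in $q$, equivalently of analytic functions for $|q|<1$. -}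

module Defs where

open import Data.Nat as ℕ using (ℕ; zero; suc; _∸_; _≤ᵇ_; _≡ᵇ_; _<ᵇ_)
open import Data.Nat.DivMod using (_%_)
open import Data.Integer as ℤ using (ℤ; +_; -_)
open import Data.Bool using (Bool; true; false; if_then_else_; not; _∧_; _∨_)
open import Data.List using (List; []; _∷_; [_]; map; concatMap; upTo)
open import Data.Product using (_×_; _,_)

PS : Set
PS = ℕ → ℤ

sumUpTo : ℕ → (ℕ → ℤ) → ℤ
sumUpTo zero    f = f 0
sumUpTo (suc n) f = sumUpTo n f ℤ.+ f (suc n)

oneₚ : PS
oneₚ zero    = + 1
oneₚ (suc _) = + 0

_+ₚ_ : PS → PS → PS
(f +ₚ g) n = f n ℤ.+ g n

-ₚ_ : PS → PS
(-ₚ f) n = - f n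

_*ₚ_ : PS → PS → PS
(f *ₚ g) n = sumUpTo n (λ i → f i ℤ.* g (n ∸ i))

shift : ℕ → PS → PS
shift s f n = if s ≤ᵇ n then f (n ∸ s) else + 0

negOnePow : ℕ → ℤ
negOnePow zero    = + 1
negOnePow (suc n) = - negOnePow n

negArg : PS → PS
negArg f n = negOnePow n ℤ.* f n

onePlusQOdd : ℕ → PS
onePlusQOdd k n = if n ≡ᵇ 0 then + 1 else (if n ≡ᵇ suc (2 ℕ.* k) then + 1 else + 0)

-- 1 / (1 - q^(2k+1)) = Σ_{m ≥ 0} q^((2k+1) m)
geomOdd : ℕ → PS
geomOdd k n = if (n % suc (2 ℕ.* k)) ≡ᵇ 0 then + 1 else + 0

finProd : ℕ → (ℕ → PS) → PS
finProd zero    f = oneₚ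
finProd (suc n) f = finProd n f *ₚ f n

-- \bar P_o(q) = (-q;q^2)_∞ / (q;q^2)_∞ = ∏_{k ≥ 0} (1 + q^(2k+1)) / (1 - q^(2k+1)).
-- The k-th factor is ≡ 1 mod q^(2k+1), so the coefficient of q^N of the
-- infinite product equals that of the partial product over k < N+1.
Pbar : PS
Pbar N = finProd (suc N) (λ k → onePlusQOdd k *ₚ geomOdd k) N

invPochOdd : ℕ → PS
invPochOdd n = finProd n geomOdd

Fterm : ℕ → PS
Fterm n = shift (n ℕ.* n) (λ m → negOnePow n ℤ.* invPochOdd n m)

-- F(q) = Σ_{n ≥ 1} Fterm n ; Fterm n = O(q^(n^2)), so only n ≤ N
-- contribute to the coefficient of q^N.
F : PS
F N = sumUpTo N (λ n → if n ≡ᵇ 0 then + 0 else Fterm n N)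

-- Representation: a list whose i-th entry (m , b) gives the multiplicity m
-- of the part 2i+1 and whether its first occurrence is overlined (b),
-- where b may be true only if m ≥ 1.

OddOP : Set
OddOP = List (ℕ × Bool)

flags : ℕ → List Bool
flags zero    = false ∷ []
flags (suc _) = false ∷ true ∷ []

-- enum k i n : all overpartitions of n into odd parts among
-- 2i+1, 2i+3, ..., 2(i+k)-1 (a list of length k, one entry per part size).
enum : ℕ → ℕ → ℕ → List OddOP
enum zero    i n = if n ≡ᵇ 0 then [ [] ] else []
enum (suc k) i n = concatMap choose (upTo (suc n))
  where
  part : ℕ
  part = suc (2 ℕ.* i)
  choose : ℕ → List OddOP
  choose m = if m ℕ.* part ≤ᵇ n
             then concatMap (λ b → map (λ rest → (m , b) ∷ rest)
                                       (enum k (suc i) (n ∸ m ℕ.* part)))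
                            (flags m)
             else []

-- All overpartitions of n into odd parts (parts 1, 3, ..., 2n+1 suffice,
-- since every part is ≤ n).
oddOverpartitions : ℕ → List OddOP
oddOverpartitions n = enum (suc n) 0 n

firstZero : OddOP → ℕ
firstZero []                 = 0
firstZero ((zero , _) ∷ _)   = 0
firstZero ((suc _ , _) ∷ r)  = suc (firstZero r)

omoex : OddOP → ℕ
omoex π = suc (2 ℕ.* firstZero π)

overlinedAtLeast : ℕ → ℕ → OddOP → Bool
overlinedAtLeast bound i []            = true
overlinedAtLeast bound i ((m , b) ∷ r) =
  (not (b ∧ (0 <ᵇ m)) ∨ (bound ≤ᵇ suc (2 ℕ.* i))) ∧ overlinedAtLeast bound (suc i) r

good : OddOP → Bool
good π = overlinedAtLeast (omoex π) 0 π

countTrue : {A : Set} → (A → Bool) → List A → ℕ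
countTrue p []       = 0
countTrue p (x ∷ xs) = if p x then suc (countTrue p xs) else countTrue p xs

mbar : ℕ → ℕ
mbar n = countTrue good (oddOverpartitions n)

Mbar : PS
Mbar n = + mbar n

-- Let A_i and C_i be the generating functions of all, resp. of the counted, overpartitions whose parts
-- are odd and at least 2i+1, and sort them by the multiplicity of the part 2i+1 and by whether it is
-- overlined. This gives A_i = (1 + q^(2i+1)) / (1 - q^(2i+1)) · A_{i+1}, so A_0 = P̄_o. For the counted
-- ones: if 2i+1 is absent, omoex is 2i+1 and the remaining parts are unrestricted; if it is present it
-- must not be overlined, and the remaining parts are again counted, one part size further on. Hence
-- C_i = A_{i+1} + q^(2i+1) / (1 - q^(2i+1)) · C_{i+1}, whose solution is
-- C_0 = P̄_o (1 - Σ_{t≥1} ∏_{j<t} q^(2j+1) / (1 + q^(2j+1))), and as Σ_{j<t} (2j+1) = t² the sum is F(-q).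
-- Only the part sizes up to 2n+1 affect the coefficient of q^n, so everything is proved for finitely
-- many part sizes.

module Submission where

open import Algebra.Bundles using (CommutativeRing)
import Algebra.Solver.Ring
import Algebra.Solver.Ring.AlmostCommutativeRing as ACR
open import Data.Bool using (Bool; true; false; if_then_else_; not; _∧_; _∨_)
open import Data.Bool.Properties using (T-≡; ¬-not; ∨-zeroʳ)
open import Data.Integer as ℤ using (ℤ; +_; -_; _+_; _*_; _-_)
import Data.Integer.Properties as ℤP
open import Data.Integer.Tactic.RingSolver using (solve-∀)
open import Data.List using (List; []; _∷_; _++_; map; concatMap; upTo)
import Data.List.Properties as ListP
open import Data.Maybe using (Maybe; just; nothing)
open import Data.Nat as ℕ using (ℕ; zero; suc; _≤_; _<_; s≤s; z≤n; _∸_; _≤ᵇ_; _≡ᵇ_; _<ᵇ_)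
open import Data.Nat.DivMod using (m≤n⇒[n∸m]%m≡n%m; m<n⇒m%n≡m)
import Data.Nat.Properties as ℕP
import Data.Nat.Tactic.RingSolver as ℕSolver
open import Data.Product using (_×_; _,_)
open import Function using (_∘_; Equivalence)
open import Level using (0ℓ)
open import Relation.Binary.Bundles using (Setoid)
open import Relation.Binary.PropositionalEquality
import Relation.Binary.Reasoning.Setoid
open import Relation.Nullary using (yes; no; contradiction)

open import Defs

≤ᵇ-true : ∀ {m n} → m ≤ n → (m ≤ᵇ n) ≡ true
≤ᵇ-true m≤n = Equivalence.to T-≡ (ℕP.≤⇒≤ᵇ m≤n)

≤ᵇ-false : ∀ {m n} → n < m → (m ≤ᵇ n) ≡ false
≤ᵇ-false {m} {n} n<m = ¬-not (λ eq → ℕP.<⇒≱ n<m (ℕP.≤ᵇ⇒≤ m n (Equivalence.from T-≡ eq)))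

≡ᵇ-false : ∀ {m n} → m ≢ n → (m ≡ᵇ n) ≡ false
≡ᵇ-false {m} {n} m≢n = ¬-not (λ eq → m≢n (ℕP.≡ᵇ⇒≡ m n (Equivalence.from T-≡ eq)))

≡ᵇ-refl : ∀ m → (m ≡ᵇ m) ≡ true
≡ᵇ-refl m = Equivalence.to T-≡ (ℕP.≡⇒≡ᵇ m m refl)

sumUpTo-cong : ∀ n {f g : ℕ → ℤ} → (∀ i → f i ≡ g i) → sumUpTo n f ≡ sumUpTo n g
sumUpTo-cong zero    f≗g = f≗g 0
sumUpTo-cong (suc n) f≗g = cong₂ _+_ (sumUpTo-cong n f≗g) (f≗g (suc n))

sumUpTo-cong≤ : ∀ n {f g : ℕ → ℤ} → (∀ i → i ≤ n → f i ≡ g i) → sumUpTo n f ≡ sumUpTo n g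
sumUpTo-cong≤ zero    f≗g = f≗g 0 z≤n
sumUpTo-cong≤ (suc n) f≗g =
  cong₂ _+_ (sumUpTo-cong≤ n (λ i i≤n → f≗g i (ℕP.m≤n⇒m≤1+n i≤n))) (f≗g (suc n) ℕP.≤-refl)

sumUpTo-head : ∀ n (f : ℕ → ℤ) → sumUpTo (suc n) f ≡ f 0 + sumUpTo n (f ∘ suc)
sumUpTo-head zero    f = refl
sumUpTo-head (suc n) f = begin
  sumUpTo (suc n) f + f (2 ℕ.+ n)             ≡⟨ cong (_+ f (2 ℕ.+ n)) (sumUpTo-head n f) ⟩
  f 0 + sumUpTo n (f ∘ suc) + f (2 ℕ.+ n)     ≡⟨ ℤP.+-assoc (f 0) _ _ ⟩
  f 0 + (sumUpTo n (f ∘ suc) + f (2 ℕ.+ n))   ∎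
  where open ≡-Reasoning

sumUpTo-+ : ∀ n (f g : ℕ → ℤ) → sumUpTo n (λ i → f i + g i) ≡ sumUpTo n f + sumUpTo n g
sumUpTo-+ zero    f g = refl
sumUpTo-+ (suc n) f g = begin
  sumUpTo n (λ i → f i + g i) + (f (suc n) + g (suc n))
    ≡⟨ cong (_+ (f (suc n) + g (suc n))) (sumUpTo-+ n f g) ⟩
  sumUpTo n f + sumUpTo n g + (f (suc n) + g (suc n))
    ≡⟨ middle-swap (sumUpTo n f) (sumUpTo n g) (f (suc n)) (g (suc n)) ⟩
  sumUpTo n f + f (suc n) + (sumUpTo n g + g (suc n))  ∎
  where
  open ≡-Reasoning
  middle-swap : ∀ a b c d → a + b + (c + d) ≡ a + c + (b + d)
  middle-swap = solve-∀

*-sumUpTo : ∀ n c (f : ℕ → ℤ) → c * sumUpTo n f ≡ sumUpTo n (λ i → c * f i)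
*-sumUpTo zero    c f = refl
*-sumUpTo (suc n) c f = trans (ℤP.*-distribˡ-+ c _ _) (cong (_+ c * f (suc n)) (*-sumUpTo n c f))

sumUpTo-zero : ∀ n (f : ℕ → ℤ) → (∀ i → i ≤ n → f i ≡ + 0) → sumUpTo n f ≡ + 0
sumUpTo-zero n f f≗0 = trans (sumUpTo-cong≤ n f≗0) (zeros n)
  where
  zeros : ∀ n → sumUpTo n (λ _ → + 0) ≡ + 0
  zeros zero    = refl
  zeros (suc n) = cong (_+ + 0) (zeros n)

sumUpTo-swap : ∀ n k (a : ℕ → ℕ → ℤ) →
  sumUpTo n (λ i → sumUpTo k (a i)) ≡ sumUpTo k (λ t → sumUpTo n (λ i → a i t))
sumUpTo-swap n zero    a = refl
sumUpTo-swap n (suc k) a =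
  trans (sumUpTo-+ n (λ i → sumUpTo k (a i)) (λ i → a i (suc k)))
        (cong (_+ sumUpTo n (λ i → a i (suc k))) (sumUpTo-swap n k a))

sumUpTo-single : ∀ n {s} (a : ℕ → ℤ) → s ≤ n → (∀ i → i ≢ s → a i ≡ + 0) → sumUpTo n a ≡ a s
sumUpTo-single zero    a z≤n  a≗0 = refl
sumUpTo-single (suc n) {s} a s≤1+n a≗0 with s ℕP.≟ suc n
... | yes refl = trans (cong (_+ a (suc n)) (sumUpTo-zero n a (λ i i≤n → a≗0 i (ℕP.<⇒≢ (s≤s i≤n)))))
                       (ℤP.+-identityˡ _)
... | no s≢1+n = trans (cong (_+_ (sumUpTo n a)) (a≗0 (suc n) (s≢1+n ∘ sym)))
                       (trans (ℤP.+-identityʳ _)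
                              (sumUpTo-single n a (ℕP.≤-pred (ℕP.≤∧≢⇒< s≤1+n s≢1+n)) a≗0))

sumUpTo-truncate : ∀ {m} n (a : ℕ → ℤ) → m ≤ n → (∀ t → m < t → a t ≡ + 0) → sumUpTo n a ≡ sumUpTo m a
sumUpTo-truncate zero    a z≤n   _   = refl
sumUpTo-truncate {m} (suc n) a m≤1+n a≗0 with m ℕP.≟ suc n
... | yes refl  = refl
... | no m≢1+n  = trans (cong₂ _+_ (sumUpTo-truncate n a m≤n a≗0) (a≗0 (suc n) (s≤s m≤n)))
                        (ℤP.+-identityʳ _)
  where m≤n = ℕP.≤-pred (ℕP.≤∧≢⇒< m≤1+n m≢1+n)

sumUpTo-exchange-head : ∀ n (f g : ℕ → ℤ) → (∀ i → f (suc i) ≡ g (suc i)) →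
  sumUpTo n f + g 0 ≡ sumUpTo n g + f 0
sumUpTo-exchange-head zero    f g _    = ℤP.+-comm (f 0) (g 0)
sumUpTo-exchange-head (suc n) f g f≗g = begin
  sumUpTo n f + f (suc n) + g 0  ≡⟨ swap-last (sumUpTo n f) (f (suc n)) (g 0) ⟩
  sumUpTo n f + g 0 + f (suc n)  ≡⟨ cong₂ _+_ (sumUpTo-exchange-head n f g f≗g) (f≗g n) ⟩
  sumUpTo n g + f 0 + g (suc n)  ≡⟨ swap-last (sumUpTo n g) (f 0) (g (suc n)) ⟩
  sumUpTo n g + g (suc n) + f 0  ∎
  where
  open ≡-Reasoning
  swap-last : ∀ a b c → a + b + c ≡ a + c + b
  swap-last = solve-∀

-- The ring of power series

infix 4 _≈_
_≈_ : PS → PS → Set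
f ≈ g = ∀ n → f n ≡ g n

≈-setoid : Setoid 0ℓ 0ℓ
≈-setoid = record
  { Carrier = PS ; _≈_ = _≈_
  ; isEquivalence = record { refl = λ _ → refl ; sym = λ f≈g n → sym (f≈g n)
                           ; trans = λ f≈g g≈h n → trans (f≈g n) (g≈h n) } }

open Setoid ≈-setoid using () renaming (refl to ≈-refl; sym to ≈-sym; trans to ≈-trans)
module ≈-Reasoning = Relation.Binary.Reasoning.Setoid ≈-setoid

zeroₚ : PS
zeroₚ _ = + 0

tailₚ : PS → PS
tailₚ f n = f (suc n)

scale : ℤ → PS → PS
scale c f n = c * f n

_-ₚ_ : PS → PS → PS
f -ₚ g = f +ₚ (-ₚ g)

*-head : ∀ f g n → (f *ₚ g) (suc n) ≡ f 0 * g (suc n) + (tailₚ f *ₚ g) n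
*-head f g n = sumUpTo-head n _

*-last : ∀ f g n → (f *ₚ g) (suc n) ≡ (f *ₚ tailₚ g) n + f (suc n) * g 0
*-last f g n = cong₂ _+_
  (sumUpTo-cong≤ n (λ i i≤n → cong (λ j → f i * g j) (ℕP.+-∸-assoc 1 i≤n)))
  (cong (λ j → f (suc n) * g j) (ℕP.n∸n≡0 n))

+-cong : ∀ {f f′ g g′} → f ≈ f′ → g ≈ g′ → (f +ₚ g) ≈ (f′ +ₚ g′)
+-cong f≈f′ g≈g′ n = cong₂ _+_ (f≈f′ n) (g≈g′ n)

neg-cong : ∀ {f f′} → f ≈ f′ → (-ₚ f) ≈ (-ₚ f′)
neg-cong f≈f′ n = cong -_ (f≈f′ n)

*-congˡ : ∀ {f f′} g → f ≈ f′ → (f *ₚ g) ≈ (f′ *ₚ g)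
*-congˡ g f≈f′ n = sumUpTo-cong n (λ i → cong (_* g (n ∸ i)) (f≈f′ i))

*-congʳ : ∀ f {g g′} → g ≈ g′ → (f *ₚ g) ≈ (f *ₚ g′)
*-congʳ f g≈g′ n = sumUpTo-cong n (λ i → cong (f i *_) (g≈g′ (n ∸ i)))

*-cong : ∀ {f f′ g g′} → f ≈ f′ → g ≈ g′ → (f *ₚ g) ≈ (f′ *ₚ g′)
*-cong {f′ = f′} {g = g} f≈f′ g≈g′ = ≈-trans (*-congˡ g f≈f′) (*-congʳ f′ g≈g′)

*-comm : ∀ f g → (f *ₚ g) ≈ (g *ₚ f)
*-comm f g zero    = ℤP.*-comm (f 0) (g 0)
*-comm f g (suc n) = begin
  (f *ₚ g) (suc n)                       ≡⟨ *-head f g n ⟩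
  f 0 * g (suc n) + (tailₚ f *ₚ g) n     ≡⟨ cong₂ _+_ (ℤP.*-comm (f 0) (g (suc n))) (*-comm (tailₚ f) g n) ⟩
  g (suc n) * f 0 + (g *ₚ tailₚ f) n     ≡⟨ ℤP.+-comm (g (suc n) * f 0) _ ⟩
  (g *ₚ tailₚ f) n + g (suc n) * f 0     ≡⟨ *-last g f n ⟨
  (g *ₚ f) (suc n)                       ∎
  where open ≡-Reasoning

*-distribˡ-+ : ∀ f g h → (f *ₚ (g +ₚ h)) ≈ ((f *ₚ g) +ₚ (f *ₚ h))
*-distribˡ-+ f g h n = trans (sumUpTo-cong n (λ i → ℤP.*-distribˡ-+ (f i) _ _)) (sumUpTo-+ n _ _)

*-distribʳ-+ : ∀ f g h → ((g +ₚ h) *ₚ f) ≈ ((g *ₚ f) +ₚ (h *ₚ f))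
*-distribʳ-+ f g h n = trans (sumUpTo-cong n (λ i → ℤP.*-distribʳ-+ (f (n ∸ i)) (g i) _)) (sumUpTo-+ n _ _)

*-scaleˡ : ∀ c f g → (scale c f *ₚ g) ≈ scale c (f *ₚ g)
*-scaleˡ c f g n = trans (sumUpTo-cong n (λ i → ℤP.*-assoc c (f i) _)) (sym (*-sumUpTo n c _))

*-zeroˡ : ∀ f → (zeroₚ *ₚ f) ≈ zeroₚ
*-zeroˡ f n = sumUpTo-zero n _ (λ i _ → ℤP.*-zeroˡ (f (n ∸ i)))

*-identityˡ : ∀ f → (oneₚ *ₚ f) ≈ f
*-identityˡ f zero    = ℤP.*-identityˡ (f 0)
*-identityˡ f (suc n) = begin
  (oneₚ *ₚ f) (suc n)                 ≡⟨ *-head oneₚ f n ⟩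
  + 1 * f (suc n) + (zeroₚ *ₚ f) n    ≡⟨ cong₂ _+_ (ℤP.*-identityˡ (f (suc n))) (*-zeroˡ f n) ⟩
  f (suc n) + + 0                     ≡⟨ ℤP.+-identityʳ _ ⟩
  f (suc n)                           ∎
  where open ≡-Reasoning

*-identityʳ : ∀ f → (f *ₚ oneₚ) ≈ f
*-identityʳ f = ≈-trans (*-comm f oneₚ) (*-identityˡ f)

*-assoc : ∀ f g h → ((f *ₚ g) *ₚ h) ≈ (f *ₚ (g *ₚ h))
*-assoc f g h zero    = ℤP.*-assoc (f 0) (g 0) (h 0)
*-assoc f g h (suc n) = begin
  ((f *ₚ g) *ₚ h) (suc n)
    ≡⟨ *-head (f *ₚ g) h n ⟩
  f 0 * g 0 * h (suc n) + (tailₚ (f *ₚ g) *ₚ h) n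
    ≡⟨ cong (_+_ (f 0 * g 0 * h (suc n))) tail-product ⟩
  f 0 * g 0 * h (suc n) + (f 0 * (tailₚ g *ₚ h) n + (tailₚ f *ₚ (g *ₚ h)) n)
    ≡⟨ regroup (f 0) (g 0) (h (suc n)) _ _ ⟩
  f 0 * (g 0 * h (suc n) + (tailₚ g *ₚ h) n) + (tailₚ f *ₚ (g *ₚ h)) n
    ≡⟨ cong (λ x → f 0 * x + (tailₚ f *ₚ (g *ₚ h)) n) (*-head g h n) ⟨
  f 0 * (g *ₚ h) (suc n) + (tailₚ f *ₚ (g *ₚ h)) n
    ≡⟨ *-head f (g *ₚ h) n ⟨
  (f *ₚ (g *ₚ h)) (suc n) ∎
  where
  open ≡-Reasoning
  tail-product : (tailₚ (f *ₚ g) *ₚ h) n ≡ f 0 * (tailₚ g *ₚ h) n + (tailₚ f *ₚ (g *ₚ h)) n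
  tail-product = begin
    (tailₚ (f *ₚ g) *ₚ h) n                                      ≡⟨ *-congˡ h (*-head f g) n ⟩
    ((scale (f 0) (tailₚ g) +ₚ (tailₚ f *ₚ g)) *ₚ h) n           ≡⟨ *-distribʳ-+ h (scale (f 0) (tailₚ g)) (tailₚ f *ₚ g) n ⟩
    (scale (f 0) (tailₚ g) *ₚ h) n + ((tailₚ f *ₚ g) *ₚ h) n     ≡⟨ cong₂ _+_ (*-scaleˡ (f 0) (tailₚ g) h n)
                                                                             (*-assoc (tailₚ f) g h n) ⟩
    f 0 * (tailₚ g *ₚ h) n + (tailₚ f *ₚ (g *ₚ h)) n             ∎
  regroup : ∀ a b c d e → a * b * c + (a * d + e) ≡ a * (b * c + d) + e
  regroup = solve-∀

powerSeriesRing : CommutativeRing 0ℓ 0ℓ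
powerSeriesRing = record
  { Carrier = PS ; _≈_ = _≈_ ; _+_ = _+ₚ_ ; _*_ = _*ₚ_ ; -_ = -ₚ_ ; 0# = zeroₚ ; 1# = oneₚ
  ; isCommutativeRing = record
    { isRing = record
      { +-isAbelianGroup = record
        { isGroup = record
          { isMonoid = record
            { isSemigroup = record
              { isMagma = record { isEquivalence = Setoid.isEquivalence ≈-setoid ; ∙-cong = +-cong }
              ; assoc = λ f g h n → ℤP.+-assoc (f n) (g n) (h n) }
            ; identity = (λ f n → ℤP.+-identityˡ (f n)) , (λ f n → ℤP.+-identityʳ (f n)) }
          ; inverse = (λ f n → ℤP.+-inverseˡ (f n)) , (λ f n → ℤP.+-inverseʳ (f n))
          ; ⁻¹-cong = neg-cong }
        ; comm = λ f g n → ℤP.+-comm (f n) (g n) }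
      ; *-cong = *-cong
      ; *-assoc = *-assoc
      ; *-identity = *-identityˡ , *-identityʳ
      ; distrib = *-distribˡ-+ , *-distribʳ-+ }
    ; *-comm = *-comm } }

private
  constₚ : ℤ → PS
  constₚ c = scale c oneₚ

  constₚ-homomorphism :
    CommutativeRing.rawRing ℤP.+-*-commutativeRing ACR.-Raw-AlmostCommutative⟶
    ACR.fromCommutativeRing powerSeriesRing
  constₚ-homomorphism = record
    { ⟦_⟧    = constₚ
    ; +-homo = λ a b n → ℤP.*-distribʳ-+ (oneₚ n) a b
    ; *-homo = λ a b → ≈-sym (≈-trans (*-scaleˡ a oneₚ (constₚ b))
                         (λ n → trans (cong (a *_) (*-identityˡ (constₚ b) n)) (sym (ℤP.*-assoc a b (oneₚ n)))))
    ; -‿homo = λ a n → sym (ℤP.neg-distribˡ-* a (oneₚ n))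
    ; 0-homo = λ n → ℤP.*-zeroˡ (oneₚ n)
    ; 1-homo = λ n → ℤP.*-identityˡ (oneₚ n) }

  constₚ-≟ : ∀ a b → Maybe (constₚ a ≈ constₚ b)
  constₚ-≟ a b with a ℤ.≟ b
  ... | yes refl = just ≈-refl
  ... | no _     = nothing

open Algebra.Solver.Ring (CommutativeRing.rawRing ℤP.+-*-commutativeRing)
  (ACR.fromCommutativeRing powerSeriesRing) constₚ-homomorphism constₚ-≟
  using (solve; _:=_; _:+_; _:*_; _:-_)

monomial : ℕ → PS
monomial s = shift s oneₚ

shift-≥ : ∀ {s n} f → s ≤ n → shift s f n ≡ f (n ∸ s)
shift-≥ {s} {n} f s≤n rewrite ≤ᵇ-true s≤n = refl

shift-< : ∀ {s n} f → n < s → shift s f n ≡ + 0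
shift-< {s} {n} f n<s rewrite ≤ᵇ-false n<s = refl

shift-cong : ∀ s {f g} → f ≈ g → shift s f ≈ shift s g
shift-cong s f≈g n with s ≤ᵇ n
... | true  = f≈g (n ∸ s)
... | false = refl

monomial-diagonal : ∀ s → monomial s s ≡ + 1
monomial-diagonal s rewrite shift-≥ {s} {s} oneₚ ℕP.≤-refl | ℕP.n∸n≡0 s = refl

monomial-off-diagonal : ∀ {s i} → i ≢ s → monomial s i ≡ + 0
monomial-off-diagonal {s} {i} i≢s with s ℕP.≤? i
... | no  s≰i = shift-< oneₚ (ℕP.≰⇒> s≰i)
... | yes s≤i rewrite shift-≥ {s} {i} oneₚ s≤i with i ∸ s in eq
...   | suc _ = refl
...   | zero  = contradiction (ℕP.≤-antisym (ℕP.m∸n≡0⇒m≤n eq) s≤i) i≢s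

monomial-* : ∀ s f → (monomial s *ₚ f) ≈ shift s f
monomial-* s f n with s ℕP.≤? n
... | yes s≤n = begin
  sumUpTo n (λ i → monomial s i * f (n ∸ i))  ≡⟨ sumUpTo-single n _ s≤n off-diagonal ⟩
  monomial s s * f (n ∸ s)                    ≡⟨ cong (_* f (n ∸ s)) (monomial-diagonal s) ⟩
  + 1 * f (n ∸ s)                             ≡⟨ ℤP.*-identityˡ _ ⟩
  f (n ∸ s)                                   ≡⟨ shift-≥ f s≤n ⟨
  shift s f n                                 ∎
  where
  open ≡-Reasoning
  off-diagonal : ∀ i → i ≢ s → monomial s i * f (n ∸ i) ≡ + 0
  off-diagonal i i≢s = trans (cong (_* f (n ∸ i)) (monomial-off-diagonal {s} i≢s)) (ℤP.*-zeroˡ (f (n ∸ i)))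
... | no s≰n = trans (sumUpTo-zero n _ vanish) (sym (shift-< f (ℕP.≰⇒> s≰n)))
  where
  vanish : ∀ i → i ≤ n → monomial s i * f (n ∸ i) ≡ + 0
  vanish i i≤n = trans (cong (_* f (n ∸ i)) (monomial-off-diagonal {s} (λ { refl → s≰n i≤n })))
                       (ℤP.*-zeroˡ (f (n ∸ i)))

shift-shift : ∀ a b f → shift a (shift b f) ≈ shift (a ℕ.+ b) f
shift-shift a b f n with a ℕP.≤? n
... | no a≰n = trans (shift-< (shift b f) (ℕP.≰⇒> a≰n))
                     (sym (shift-< f (ℕP.<-≤-trans (ℕP.≰⇒> a≰n) (ℕP.m≤m+n a b))))
... | yes a≤n rewrite shift-≥ (shift b f) a≤n with b ℕP.≤? (n ∸ a)
...   | yes b≤n∸a rewrite shift-≥ f b≤n∸a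
                        | shift-≥ {a ℕ.+ b} {n} f (subst (_≤ n) (ℕP.+-comm b a) (ℕP.m≤o∸n⇒m+n≤o b a≤n b≤n∸a))
                        = cong f (ℕP.∸-+-assoc n a b)
...   | no  b≰n∸a = trans (shift-< f (ℕP.≰⇒> b≰n∸a))
                          (sym (shift-< f (ℕP.≰⇒> (λ a+b≤n →
                            b≰n∸a (ℕP.m+n≤o⇒m≤o∸n b (subst (_≤ n) (ℕP.+-comm a b) a+b≤n))))))

monomial-+ : ∀ a b → monomial (a ℕ.+ b) ≈ (monomial a *ₚ monomial b)
monomial-+ a b = ≈-sym (≈-trans (monomial-* a (monomial b)) (shift-shift a b oneₚ))

negOnePow-+ : ∀ a b → negOnePow (a ℕ.+ b) ≡ negOnePow a * negOnePow b
negOnePow-+ zero    b = sym (ℤP.*-identityˡ _)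
negOnePow-+ (suc a) b = trans (cong -_ (negOnePow-+ a b)) (ℤP.neg-distribˡ-* (negOnePow a) (negOnePow b))

negOnePow-square : ∀ a → negOnePow a * negOnePow a ≡ + 1
negOnePow-square zero    = refl
negOnePow-square (suc a) = trans (neg-square (negOnePow a)) (negOnePow-square a)
  where
  neg-square : ∀ x → - x * - x ≡ x * x
  neg-square = solve-∀

negOnePow-even : ∀ k → negOnePow (k ℕ.+ k) ≡ + 1
negOnePow-even k = trans (negOnePow-+ k k) (negOnePow-square k)

negOnePow-split : ∀ {i n} → i ≤ n → negOnePow n ≡ negOnePow i * negOnePow (n ∸ i)
negOnePow-split {i} {n} i≤n = trans (cong negOnePow (sym (ℕP.m+[n∸m]≡n i≤n))) (negOnePow-+ i (n ∸ i))

negOnePow-*-self : ∀ t → negOnePow (t ℕ.* t) ≡ negOnePow t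
negOnePow-*-self zero    = refl
negOnePow-*-self (suc t) = begin
  negOnePow (suc t ℕ.* suc t)                     ≡⟨ cong negOnePow (expand t) ⟩
  negOnePow (suc (t ℕ.+ t) ℕ.+ t ℕ.* t)           ≡⟨ negOnePow-+ (suc (t ℕ.+ t)) (t ℕ.* t) ⟩
  - negOnePow (t ℕ.+ t) * negOnePow (t ℕ.* t)     ≡⟨ cong₂ (λ a b → - a * b) (negOnePow-even t) (negOnePow-*-self t) ⟩
  - + 1 * negOnePow t                             ≡⟨ ℤP.-1*i≡-i (negOnePow t) ⟩
  negOnePow (suc t)                               ∎
  where
  open ≡-Reasoning
  expand : ∀ t → suc t ℕ.* suc t ≡ suc (t ℕ.+ t) ℕ.+ t ℕ.* t
  expand = ℕSolver.solve-∀

negArg-cong : ∀ {f g} → f ≈ g → negArg f ≈ negArg g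
negArg-cong f≈g n = cong (negOnePow n *_) (f≈g n)

negArg-+ : ∀ f g → negArg (f +ₚ g) ≈ (negArg f +ₚ negArg g)
negArg-+ f g n = ℤP.*-distribˡ-+ (negOnePow n) (f n) (g n)

negArg-neg : ∀ f → negArg (-ₚ f) ≈ (-ₚ negArg f)
negArg-neg f n = sym (ℤP.neg-distribʳ-* (negOnePow n) (f n))

negArg-one : negArg oneₚ ≈ oneₚ
negArg-one zero    = refl
negArg-one (suc n) = ℤP.*-zeroʳ (negOnePow (suc n))

negArg-* : ∀ f g → negArg (f *ₚ g) ≈ (negArg f *ₚ negArg g)
negArg-* f g n = trans (*-sumUpTo n (negOnePow n) _) (sumUpTo-cong≤ n split-sign)
  where
  split-sign : ∀ i → i ≤ n →
    negOnePow n * (f i * g (n ∸ i)) ≡ negOnePow i * f i * (negOnePow (n ∸ i) * g (n ∸ i))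
  split-sign i i≤n rewrite negOnePow-split i≤n = interchange (negOnePow i) (negOnePow (n ∸ i)) (f i) (g (n ∸ i))
    where
    interchange : ∀ a b c d → a * b * (c * d) ≡ a * c * (b * d)
    interchange = solve-∀

negArg-scale : ∀ c f → negArg (scale c f) ≈ scale c (negArg f)
negArg-scale c f n = trans (sym (ℤP.*-assoc (negOnePow n) c (f n)))
  (trans (cong (_* f n) (ℤP.*-comm (negOnePow n) c)) (ℤP.*-assoc c (negOnePow n) (f n)))

negArg-shift : ∀ s f → negArg (shift s f) ≈ scale (negOnePow s) (shift s (negArg f))
negArg-shift s f n with s ℕP.≤? n
... | yes s≤n rewrite shift-≥ f s≤n | shift-≥ (negArg f) s≤n =
  trans (cong (_* f (n ∸ s)) (negOnePow-split s≤n)) (ℤP.*-assoc (negOnePow s) (negOnePow (n ∸ s)) (f (n ∸ s)))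
... | no s≰n rewrite shift-< f (ℕP.≰⇒> s≰n) | shift-< (negArg f) (ℕP.≰⇒> s≰n) =
  trans (ℤP.*-zeroʳ (negOnePow n)) (sym (ℤP.*-zeroʳ (negOnePow s)))

shift-scale : ∀ s c f → shift s (scale c f) ≈ scale c (shift s f)
shift-scale s c f n with s ≤ᵇ n
... | true  = refl
... | false = sym (ℤP.*-zeroʳ c)

oddPart : ℕ → ℕ
oddPart i = suc (2 ℕ.* i)

qOdd : ℕ → PS
qOdd i = monomial (oddPart i)

geomOdd-unfold : ∀ i → geomOdd i ≈ (oneₚ +ₚ (qOdd i *ₚ geomOdd i))
geomOdd-unfold i n = trans (unfold n) (cong (_+_ (oneₚ n)) (sym (monomial-* (oddPart i) (geomOdd i) n)))
  where
  unfold : geomOdd i ≈ (oneₚ +ₚ shift (oddPart i) (geomOdd i))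
  unfold n with oddPart i ℕP.≤? n
  ... | yes s≤n@(s≤s _) rewrite shift-≥ (geomOdd i) s≤n =
    trans (cong (λ r → if r ≡ᵇ 0 then + 1 else + 0) (sym (m≤n⇒[n∸m]%m≡n%m s≤n))) (sym (ℤP.+-identityˡ _))
  ... | no s≰n rewrite shift-< (geomOdd i) (ℕP.≰⇒> s≰n) with n
  ...   | zero  = refl
  ...   | suc _ rewrite m<n⇒m%n≡m (ℕP.≰⇒> s≰n) = refl

geomOdd-inverse : ∀ i → (geomOdd i *ₚ (oneₚ -ₚ qOdd i)) ≈ oneₚ
geomOdd-inverse i = begin
  G *ₚ (oneₚ -ₚ X)                   ≈⟨ solve 3 (λ G O X → G :* (O :- X) := G :* O :- X :* G) ≈-refl G oneₚ X ⟩
  (G *ₚ oneₚ) -ₚ (X *ₚ G)           ≈⟨ +-cong (≈-trans (*-identityʳ G) (geomOdd-unfold i)) ≈-refl ⟩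
  (oneₚ +ₚ (X *ₚ G)) -ₚ (X *ₚ G)     ≈⟨ solve 2 (λ O Y → O :+ Y :- Y := O) ≈-refl oneₚ (X *ₚ G) ⟩
  oneₚ                               ∎
  where
  open ≈-Reasoning
  G = geomOdd i
  X = qOdd i

geomOdd-unique : ∀ i {R H} → R ≈ (H +ₚ (qOdd i *ₚ R)) → R ≈ (geomOdd i *ₚ H)
geomOdd-unique i {R} {H} R≈H+XR = begin
  R                                    ≈⟨ *-identityˡ R ⟨
  oneₚ *ₚ R                            ≈⟨ *-congˡ R (geomOdd-inverse i) ⟨
  (G *ₚ (oneₚ -ₚ X)) *ₚ R              ≈⟨ solve 4 (λ G O X R → (G :* (O :- X)) :* R := G :* (O :* R :- X :* R))
                                                ≈-refl G oneₚ X R ⟩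
  G *ₚ ((oneₚ *ₚ R) -ₚ (X *ₚ R))       ≈⟨ *-congʳ G (+-cong {g = -ₚ (X *ₚ R)} (≈-trans (*-identityˡ R) R≈H+XR) ≈-refl) ⟩
  G *ₚ ((H +ₚ (X *ₚ R)) -ₚ (X *ₚ R))   ≈⟨ *-congʳ G (solve 2 (λ H Y → H :+ Y :- Y := H) ≈-refl H (X *ₚ R)) ⟩
  G *ₚ H                               ∎
  where
  open ≈-Reasoning
  G = geomOdd i
  X = qOdd i

onePlusQOdd-≈ : ∀ i → onePlusQOdd i ≈ (oneₚ +ₚ qOdd i)
onePlusQOdd-≈ i zero    = refl
onePlusQOdd-≈ i (suc m) with suc m ℕP.≟ oddPart i
... | yes refl rewrite ≡ᵇ-refl (oddPart i) = sym (trans (ℤP.+-identityˡ _) (monomial-diagonal (oddPart i)))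
... | no  m≢s  rewrite ≡ᵇ-false m≢s = sym (trans (ℤP.+-identityˡ _) (monomial-off-diagonal {oddPart i} m≢s))

negArg-qOdd : ∀ i → negArg (qOdd i) ≈ (-ₚ qOdd i)
negArg-qOdd i n = begin
  negArg (qOdd i) n                                          ≡⟨ negArg-shift (oddPart i) oneₚ n ⟩
  negOnePow (oddPart i) * shift (oddPart i) (negArg oneₚ) n
    ≡⟨ cong₂ _*_ (cong -_ (negOnePow-odd)) (shift-cong (oddPart i) negArg-one n) ⟩
  - + 1 * qOdd i n                                           ≡⟨ ℤP.-1*i≡-i (qOdd i n) ⟩
  - qOdd i n                                                 ∎
  where
  open ≡-Reasoning
  negOnePow-odd : negOnePow (2 ℕ.* i) ≡ + 1
  negOnePow-odd = trans (cong (λ j → negOnePow (i ℕ.+ j)) (ℕP.+-identityʳ i)) (negOnePow-even i)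

onePlusQOdd-negArg-geomOdd : ∀ i → ((oneₚ +ₚ qOdd i) *ₚ negArg (geomOdd i)) ≈ oneₚ
onePlusQOdd-negArg-geomOdd i = begin
  (oneₚ +ₚ X) *ₚ negArg G               ≈⟨ *-congˡ (negArg G) negArg-one-minus ⟨
  negArg (oneₚ -ₚ X) *ₚ negArg G        ≈⟨ negArg-* (oneₚ -ₚ X) G ⟨
  negArg ((oneₚ -ₚ X) *ₚ G)             ≈⟨ negArg-cong (≈-trans (*-comm (oneₚ -ₚ X) G) (geomOdd-inverse i)) ⟩
  negArg oneₚ                           ≈⟨ negArg-one ⟩
  oneₚ                                  ∎
  where
  open ≈-Reasoning
  G = geomOdd i
  X = qOdd i
  negArg-one-minus : negArg (oneₚ -ₚ X) ≈ (oneₚ +ₚ X)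
  negArg-one-minus = ≈-trans (negArg-+ oneₚ (-ₚ X))
    (+-cong negArg-one (≈-trans (negArg-neg X) (λ n → trans (cong -_ (negArg-qOdd i n)) (ℤP.neg-involutive _))))

oddFactor : ℕ → PS
oddFactor i = onePlusQOdd i *ₚ geomOdd i

yFactor : ℕ → PS
yFactor i = qOdd i *ₚ negArg (geomOdd i)

geomOdd-*-unfold : ∀ i B → (geomOdd i *ₚ B) ≈ (B +ₚ (qOdd i *ₚ (geomOdd i *ₚ B)))
geomOdd-*-unfold i B = begin
  G *ₚ B                              ≈⟨ *-congˡ B (geomOdd-unfold i) ⟩
  (oneₚ +ₚ (X *ₚ G)) *ₚ B             ≈⟨ solve 4 (λ O X G B → (O :+ X :* G) :* B := O :* B :+ X :* (G :* B)) ≈-refl oneₚ X G B ⟩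
  (oneₚ *ₚ B) +ₚ (X *ₚ (G *ₚ B))      ≈⟨ +-cong (*-identityˡ B) ≈-refl ⟩
  B +ₚ (X *ₚ (G *ₚ B))                ∎
  where
  open ≈-Reasoning
  G = geomOdd i
  X = qOdd i

-- In particular oddFactor i ≡ 1 (mod q^(2i+1)).
oddFactor-* : ∀ i B → (oddFactor i *ₚ B) ≈ (B +ₚ (qOdd i *ₚ ((geomOdd i +ₚ geomOdd i) *ₚ B)))
oddFactor-* i B = begin
  (onePlusQOdd i *ₚ G) *ₚ B           ≈⟨ *-congˡ B (*-congˡ G (onePlusQOdd-≈ i)) ⟩
  ((oneₚ +ₚ X) *ₚ G) *ₚ B
    ≈⟨ solve 4 (λ O X G B → ((O :+ X) :* G) :* B := O :* (G :* B) :+ X :* (G :* B)) ≈-refl oneₚ X G B ⟩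
  (oneₚ *ₚ (G *ₚ B)) +ₚ (X *ₚ (G *ₚ B))  ≈⟨ +-cong (≈-trans (*-identityˡ (G *ₚ B)) (geomOdd-*-unfold i B)) ≈-refl ⟩
  (B +ₚ (X *ₚ (G *ₚ B))) +ₚ (X *ₚ (G *ₚ B))
    ≈⟨ solve 3 (λ X G B → (B :+ X :* (G :* B)) :+ X :* (G :* B) := B :+ X :* ((G :+ G) :* B)) ≈-refl X G B ⟩
  B +ₚ (X *ₚ ((G +ₚ G) *ₚ B))         ∎
  where
  open ≈-Reasoning
  G = geomOdd i
  X = qOdd i

oddFactor-*-yFactor : ∀ i → (oddFactor i *ₚ yFactor i) ≈ (qOdd i *ₚ geomOdd i)
oddFactor-*-yFactor i = begin
  (onePlusQOdd i *ₚ G) *ₚ (X *ₚ H)    ≈⟨ *-congˡ (X *ₚ H) (*-congˡ G (onePlusQOdd-≈ i)) ⟩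
  ((oneₚ +ₚ X) *ₚ G) *ₚ (X *ₚ H)
    ≈⟨ solve 4 (λ U G X H → (U :* G) :* (X :* H) := (X :* G) :* (U :* H)) ≈-refl (oneₚ +ₚ X) G X H ⟩
  (X *ₚ G) *ₚ ((oneₚ +ₚ X) *ₚ H)      ≈⟨ *-congʳ (X *ₚ G) (onePlusQOdd-negArg-geomOdd i) ⟩
  (X *ₚ G) *ₚ oneₚ                    ≈⟨ *-identityʳ (X *ₚ G) ⟩
  X *ₚ G                              ∎
  where
  open ≈-Reasoning
  G = geomOdd i
  H = negArg (geomOdd i)
  X = qOdd i

*-oddFactor-low : ∀ P i {m} → m < oddPart i → (P *ₚ oddFactor i) m ≡ P m
*-oddFactor-low P i {m} m<s = begin
  (P *ₚ oddFactor i) m                         ≡⟨ *-comm P (oddFactor i) m ⟩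
  (oddFactor i *ₚ P) m                         ≡⟨ oddFactor-* i P m ⟩
  P m + (qOdd i *ₚ Q) m                        ≡⟨ cong (_+_ (P m)) (trans (monomial-* (oddPart i) Q m) (shift-< Q m<s)) ⟩
  P m + + 0                                    ≡⟨ ℤP.+-identityʳ (P m) ⟩
  P m                                          ∎
  where
  open ≡-Reasoning
  Q = (geomOdd i +ₚ geomOdd i) *ₚ P

finProd-cong : ∀ t {f g} → (∀ j → f j ≈ g j) → finProd t f ≈ finProd t g
finProd-cong zero    f≈g = ≈-refl
finProd-cong (suc t) f≈g = *-cong (finProd-cong t f≈g) (f≈g t)

finProd-head : ∀ t (f : ℕ → PS) → finProd (suc t) f ≈ (f 0 *ₚ finProd t (f ∘ suc))
finProd-head zero    f = ≈-trans (*-identityˡ (f 0)) (≈-sym (*-identityʳ (f 0)))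
finProd-head (suc t) f = ≈-trans (*-congˡ (f (suc t)) (finProd-head t f)) (*-assoc (f 0) (finProd t (f ∘ suc)) (f (suc t)))

finProd-from : ∀ t (f : ℕ → PS) i →
  finProd (suc t) (λ j → f (i ℕ.+ j)) ≈ (f i *ₚ finProd t (λ j → f (suc i ℕ.+ j)))
finProd-from t f i = ≈-trans (finProd-head t (λ j → f (i ℕ.+ j)))
  (*-cong (λ n → cong (λ k → f k n) (ℕP.+-identityʳ i))
          (finProd-cong t (λ j n → cong (λ k → f k n) (ℕP.+-suc i j))))

finProd-* : ∀ t (f g : ℕ → PS) → (finProd t f *ₚ finProd t g) ≈ finProd t (λ j → f j *ₚ g j)
finProd-* zero    f g = *-identityˡ oneₚ
finProd-* (suc t) f g = ≈-trans
  (solve 4 (λ A x B y → (A :* x) :* (B :* y) := (A :* B) :* (x :* y)) ≈-refl (finProd t f) (f t) (finProd t g) (g t))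
  (*-congˡ (f t *ₚ g t) (finProd-* t f g))

negArg-finProd : ∀ t (f : ℕ → PS) → negArg (finProd t f) ≈ finProd t (negArg ∘ f)
negArg-finProd zero    f = negArg-one
negArg-finProd (suc t) f = ≈-trans (negArg-* (finProd t f) (f t)) (*-congˡ (negArg (f t)) (negArg-finProd t f))

monomial-square : ∀ t → monomial (t ℕ.* t) ≈ finProd t qOdd
monomial-square zero    = ≈-refl
monomial-square (suc t) = begin
  monomial (suc t ℕ.* suc t)                  ≡⟨ cong monomial (expand t) ⟩
  monomial (t ℕ.* t ℕ.+ oddPart t)            ≈⟨ monomial-+ (t ℕ.* t) (oddPart t) ⟩
  monomial (t ℕ.* t) *ₚ qOdd t                ≈⟨ *-congˡ (qOdd t) (monomial-square t) ⟩
  finProd t qOdd *ₚ qOdd t                    ∎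
  where
  open ≈-Reasoning
  expand : ∀ t → suc t ℕ.* suc t ≡ t ℕ.* t ℕ.+ suc (2 ℕ.* t)
  expand = ℕSolver.solve-∀

-- Counting overpartitions into odd parts

multiplesSum : ℕ → PS → ℕ → ℕ → ℤ
multiplesSum s h L n = sumUpTo L (λ m → if m ℕ.* s ≤ᵇ n then h (n ∸ m ℕ.* s) else + 0)

multiplesSum-suc : ∀ s h L {n} → s ≤ n → multiplesSum s h (suc L) n ≡ h n + multiplesSum s h L (n ∸ s)
multiplesSum-suc s h L {n} s≤n =
  trans (sumUpTo-head L _) (cong (_+_ (h n)) (sumUpTo-cong L shifted-term))
  where
  shifted-term : ∀ m → (if s ℕ.+ m ℕ.* s ≤ᵇ n then h (n ∸ (s ℕ.+ m ℕ.* s)) else + 0)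
                     ≡ (if m ℕ.* s ≤ᵇ n ∸ s then h (n ∸ s ∸ m ℕ.* s) else + 0)
  shifted-term m rewrite sym (ℕP.∸-+-assoc n s (m ℕ.* s)) with m ℕ.* s ℕP.≤? n ∸ s
  ... | yes ms≤n∸s rewrite ≤ᵇ-true ms≤n∸s
                         | ≤ᵇ-true (subst (_≤ n) (ℕP.+-comm (m ℕ.* s) s) (ℕP.m≤o∸n⇒m+n≤o (m ℕ.* s) s≤n ms≤n∸s)) = refl
  ... | no  ms≰n∸s rewrite ≤ᵇ-false (ℕP.≰⇒> ms≰n∸s)
                         | ≤ᵇ-false (ℕP.≰⇒> (λ s+ms≤n → ms≰n∸s
                             (ℕP.m+n≤o⇒m≤o∸n (m ℕ.* s) (subst (_≤ n) (ℕP.+-comm s (m ℕ.* s)) s+ms≤n)))) = refl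

multiplesSum-< : ∀ s h L {n} → n < s → multiplesSum s h L n ≡ h n
multiplesSum-< s h L {n} n<s = sumUpTo-truncate L _ z≤n vanish
  where
  vanish : ∀ m → 0 < m → (if m ℕ.* s ≤ᵇ n then h (n ∸ m ℕ.* s) else + 0) ≡ + 0
  vanish (suc m) _ rewrite ≤ᵇ-false (ℕP.<-≤-trans n<s (ℕP.m≤m+n s (m ℕ.* s))) = refl

multiplesSum-stable : ∀ s h {L n} → n ≤ L → multiplesSum (suc s) h L n ≡ multiplesSum (suc s) h n n
multiplesSum-stable s h {L} {n} n≤L = sumUpTo-truncate L _ n≤L vanish
  where
  vanish : ∀ m → n < m → (if m ℕ.* suc s ≤ᵇ n then h (n ∸ m ℕ.* suc s) else + 0) ≡ + 0
  vanish m n<m rewrite ≤ᵇ-false (ℕP.<-≤-trans n<m (ℕP.m≤m*n m (suc s))) = refl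

multiplesSeries : ℕ → PS → PS
multiplesSeries s h n = multiplesSum s h n n

multiplesSeries-≈ : ∀ i h → multiplesSeries (oddPart i) h ≈ (geomOdd i *ₚ h)
multiplesSeries-≈ i h = geomOdd-unique i {H = h} (λ n → trans (unfold n) (cong (_+_ (h n)) (sym (monomial-* s R n))))
  where
  s = oddPart i
  R = multiplesSeries s h
  unfold : ∀ n → R n ≡ h n + shift s R n
  unfold zero    = sym (ℤP.+-identityʳ (h 0))
  unfold (suc n) with s ℕP.≤? suc n
  ... | yes s≤1+n rewrite shift-≥ R s≤1+n =
    trans (multiplesSum-suc s h n s≤1+n)
          (cong (_+_ (h (suc n))) (multiplesSum-stable (2 ℕ.* i) h (ℕP.m∸n≤m n (2 ℕ.* i))))
  ... | no  s≰1+n rewrite shift-< R (ℕP.≰⇒> s≰1+n) =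
    trans (multiplesSum-< s h (suc n) (ℕP.≰⇒> s≰1+n)) (sym (ℤP.+-identityʳ (h (suc n))))

module _ {A : Set} where

  countTrue-++ : ∀ (p : A → Bool) xs ys → countTrue p (xs ++ ys) ≡ countTrue p xs ℕ.+ countTrue p ys
  countTrue-++ p []       ys = refl
  countTrue-++ p (x ∷ xs) ys with p x
  ... | true  = cong suc (countTrue-++ p xs ys)
  ... | false = countTrue-++ p xs ys

  countTrue-cong : ∀ {p q : A → Bool} xs → (∀ x → p x ≡ q x) → countTrue p xs ≡ countTrue q xs
  countTrue-cong []       p≗q = refl
  countTrue-cong {p} {q} (x ∷ xs) p≗q rewrite p≗q x with q x
  ... | true  = cong suc (countTrue-cong xs p≗q)
  ... | false = countTrue-cong xs p≗q

  countTrue-none : ∀ {p : A → Bool} xs → (∀ x → p x ≡ false) → countTrue p xs ≡ 0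
  countTrue-none []       p≗false = refl
  countTrue-none {p} (x ∷ xs) p≗false rewrite p≗false x = countTrue-none xs p≗false

  countTrue-concatMap-upTo : ∀ (p : A → Bool) (c : ℕ → List A) n →
    + countTrue p (concatMap c (upTo (suc n))) ≡ sumUpTo n (λ m → + countTrue p (c m))
  countTrue-concatMap-upTo p c zero    = cong (λ xs → + countTrue p xs) (ListP.++-identityʳ (c 0))
  countTrue-concatMap-upTo p c (suc n) = begin
    + countTrue p (concatMap c (upTo (2 ℕ.+ n)))
      ≡⟨ cong (λ xs → + countTrue p (concatMap c xs)) (ListP.upTo-∷ʳ (suc n)) ⟨
    + countTrue p (concatMap c (upTo (suc n) ++ suc n ∷ []))
      ≡⟨ cong (λ xs → + countTrue p xs) (ListP.concatMap-++ c (upTo (suc n)) (suc n ∷ [])) ⟩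
    + countTrue p (concatMap c (upTo (suc n)) ++ (c (suc n) ++ []))
      ≡⟨ cong +_ (countTrue-++ p (concatMap c (upTo (suc n))) (c (suc n) ++ [])) ⟩
    + (countTrue p (concatMap c (upTo (suc n))) ℕ.+ countTrue p (c (suc n) ++ []))
      ≡⟨ ℤP.pos-+ (countTrue p (concatMap c (upTo (suc n)))) (countTrue p (c (suc n) ++ [])) ⟩
    + countTrue p (concatMap c (upTo (suc n))) + + countTrue p (c (suc n) ++ [])
      ≡⟨ cong₂ (λ x ys → x + + countTrue p ys) (countTrue-concatMap-upTo p c n) (ListP.++-identityʳ (c (suc n))) ⟩
    sumUpTo n (λ m → + countTrue p (c m)) + + countTrue p (c (suc n))  ∎
    where open ≡-Reasoning

  countTrue-map : ∀ {B : Set} (p : B → Bool) (f : A → B) xs → countTrue p (map f xs) ≡ countTrue (p ∘ f) xs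
  countTrue-map p f []       = refl
  countTrue-map p f (x ∷ xs) with p (f x)
  ... | true  = cong suc (countTrue-map p f xs)
  ... | false = countTrue-map p f xs

-- The members of enum (suc k) i n in which 2i+1 has multiplicity m, where r = n - m (2i+1).
extensions : ℕ → ℕ → ℕ → ℕ → List OddOP
extensions k i m r = concatMap (λ b → map ((m , b) ∷_) (enum k (suc i) r)) (flags m)

countTrue-enum-suc : ∀ p k i n → + countTrue p (enum (suc k) i n) ≡
  sumUpTo n (λ m → if m ℕ.* oddPart i ≤ᵇ n then + countTrue p (extensions k i m (n ∸ m ℕ.* oddPart i)) else + 0)
countTrue-enum-suc p k i n = trans (countTrue-concatMap-upTo p choose n) (sumUpTo-cong n count-if)
  where
  choose : ℕ → List OddOP
  choose m = if m ℕ.* oddPart i ≤ᵇ n then extensions k i m (n ∸ m ℕ.* oddPart i) else []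
  count-if : ∀ m → + countTrue p (choose m) ≡
    (if m ℕ.* oddPart i ≤ᵇ n then + countTrue p (extensions k i m (n ∸ m ℕ.* oddPart i)) else + 0)
  count-if m with m ℕ.* oddPart i ≤ᵇ n
  ... | true  = refl
  ... | false = refl

-- Removing the multiplicity-0 term turns the count into a sum over multiples of 2i+1.
countTrue-enum-suc-≈ : ∀ p k i (H : PS) → (∀ m r → + countTrue p (extensions k i (suc m) r) ≡ H r) →
  ∀ n → + countTrue p (enum (suc k) i n) + H n ≡ multiplesSeries (oddPart i) H n + + countTrue p (extensions k i 0 n)
countTrue-enum-suc-≈ p k i H ext≡H n =
  trans (cong (_+ H n) (countTrue-enum-suc p k i n)) (sumUpTo-exchange-head n _ _ agree)
  where
  s = oddPart i
  agree : ∀ m → (if suc m ℕ.* s ≤ᵇ n then + countTrue p (extensions k i (suc m) (n ∸ suc m ℕ.* s)) else + 0)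
              ≡ (if suc m ℕ.* s ≤ᵇ n then H (n ∸ suc m ℕ.* s) else + 0)
  agree m with suc m ℕ.* s ≤ᵇ n
  ... | true  = ext≡H m (n ∸ suc m ℕ.* s)
  ... | false = refl

-- goodAt i treats 2i+1 as the smallest part size; good π is goodAt 0 π.
goodAt : ℕ → OddOP → Bool
goodAt i π = overlinedAtLeast (oddPart (i ℕ.+ firstZero π)) i π

overlinedAtLeast-small : ∀ {bound} j π → bound ≤ oddPart j → overlinedAtLeast bound j π ≡ true
overlinedAtLeast-small j []            _         = refl
overlinedAtLeast-small j ((m , b) ∷ π) bound≤2j+1 rewrite ≤ᵇ-true bound≤2j+1 | ∨-zeroʳ (not (b ∧ (0 <ᵇ m))) =
  overlinedAtLeast-small (suc j) π (ℕP.≤-trans bound≤2j+1 (s≤s (ℕP.*-monoʳ-≤ 2 (ℕP.n≤1+n j))))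

goodAt-absent : ∀ i π → goodAt i ((0 , false) ∷ π) ≡ true
goodAt-absent i π =
  overlinedAtLeast-small (suc i) π (s≤s (ℕP.*-monoʳ-≤ 2 (ℕP.m≤n⇒m≤1+n (ℕP.≤-reflexive (ℕP.+-identityʳ i)))))

goodAt-plain : ∀ i m π → goodAt i ((suc m , false) ∷ π) ≡ goodAt (suc i) π
goodAt-plain i m π = cong (λ j → overlinedAtLeast (oddPart j) (suc i) π) (ℕP.+-suc i (firstZero π))

goodAt-overlined : ∀ i m π → goodAt i ((suc m , true) ∷ π) ≡ false
goodAt-overlined i m π rewrite ≤ᵇ-false {oddPart (i ℕ.+ suc (firstZero π))} {oddPart i}
  (s≤s (ℕP.*-monoʳ-< 2 (ℕP.m<m+n i (s≤s z≤n)))) = refl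

module _ (p : OddOP → Bool) (k i r : ℕ) where

  countTrue-extensions-absent :
    countTrue p (extensions k i 0 r) ≡ countTrue (λ π → p ((0 , false) ∷ π)) (enum k (suc i) r)
  countTrue-extensions-absent =
    trans (cong (countTrue p) (ListP.++-identityʳ (map ((0 , false) ∷_) E))) (countTrue-map p ((0 , false) ∷_) E)
    where E = enum k (suc i) r

  countTrue-extensions-present : ∀ m → countTrue p (extensions k i (suc m) r) ≡
    countTrue (λ π → p ((suc m , false) ∷ π)) (enum k (suc i) r) ℕ.+
    countTrue (λ π → p ((suc m , true) ∷ π)) (enum k (suc i) r)
  countTrue-extensions-present m = begin
    countTrue p (map (plain ∷_) E ++ map (overlined ∷_) E ++ [])
      ≡⟨ countTrue-++ p (map (plain ∷_) E) (map (overlined ∷_) E ++ []) ⟩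
    countTrue p (map (plain ∷_) E) ℕ.+ countTrue p (map (overlined ∷_) E ++ [])
      ≡⟨ cong (λ xs → countTrue p (map (plain ∷_) E) ℕ.+ countTrue p xs) (ListP.++-identityʳ (map (overlined ∷_) E)) ⟩
    countTrue p (map (plain ∷_) E) ℕ.+ countTrue p (map (overlined ∷_) E)
      ≡⟨ cong₂ ℕ._+_ (countTrue-map p (plain ∷_) E) (countTrue-map p (overlined ∷_) E) ⟩
    countTrue (λ π → p (plain ∷ π)) E ℕ.+ countTrue (λ π → p (overlined ∷ π)) E  ∎
    where
    open ≡-Reasoning
    E = enum k (suc i) r
    plain overlined : ℕ × Bool
    plain     = suc m , false
    overlined = suc m , true

allSeries : ℕ → ℕ → PS
allSeries k i n = + countTrue (λ _ → true) (enum k i n)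

goodSeries : ℕ → ℕ → PS
goodSeries k i n = + countTrue (goodAt i) (enum k i n)

allSeries-zero : ∀ i → allSeries 0 i ≈ oneₚ
allSeries-zero i zero    = refl
allSeries-zero i (suc n) = refl

goodSeries-zero : ∀ i → goodSeries 0 i ≈ oneₚ
goodSeries-zero i zero    = refl
goodSeries-zero i (suc n) = refl

-- Each multiplicity m ≥ 1 of the part 2i+1 comes with or without an overline.
allSeries-suc-+ : ∀ k i → let A = allSeries k (suc i) in
  (allSeries (suc k) i +ₚ (A +ₚ A)) ≈ ((geomOdd i *ₚ (A +ₚ A)) +ₚ A)
allSeries-suc-+ k i n = begin
  allSeries (suc k) i n + (A +ₚ A) n                            ≡⟨ countTrue-enum-suc-≈ (λ _ → true) k i (A +ₚ A) twice n ⟩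
  multiplesSeries (oddPart i) (A +ₚ A) n + + count 0 n          ≡⟨ cong₂ _+_ (multiplesSeries-≈ i (A +ₚ A) n)
                                                                        (cong +_ (countTrue-extensions-absent (λ _ → true) k i n)) ⟩
  (geomOdd i *ₚ (A +ₚ A)) n + A n                               ∎
  where
  open ≡-Reasoning
  A = allSeries k (suc i)
  count : ℕ → ℕ → ℕ
  count m r = countTrue (λ _ → true) (extensions k i m r)
  twice : ∀ m r → + count (suc m) r ≡ (A +ₚ A) r
  twice m r = trans (cong +_ (countTrue-extensions-present (λ _ → true) k i r m)) (ℤP.pos-+ a a)
    where a = countTrue (λ _ → true) (enum k (suc i) r)

-- With 2i+1 absent every overlined part exceeds the smallest missing part; an overlined 2i+1 never does.
goodSeries-suc-+ : ∀ k i → let A = allSeries k (suc i) ; C = goodSeries k (suc i) in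
  (goodSeries (suc k) i +ₚ C) ≈ ((geomOdd i *ₚ C) +ₚ A)
goodSeries-suc-+ k i n = begin
  goodSeries (suc k) i n + C n                                  ≡⟨ countTrue-enum-suc-≈ (goodAt i) k i C plain-only n ⟩
  multiplesSeries (oddPart i) C n + + count 0 n                 ≡⟨ cong₂ _+_ (multiplesSeries-≈ i C n) (cong +_ all-good) ⟩
  (geomOdd i *ₚ C) n + A n                                      ∎
  where
  open ≡-Reasoning
  A = allSeries k (suc i)
  C = goodSeries k (suc i)
  count : ℕ → ℕ → ℕ
  count m r = countTrue (goodAt i) (extensions k i m r)
  all-good : count 0 n ≡ countTrue (λ _ → true) (enum k (suc i) n)
  all-good = trans (countTrue-extensions-absent (goodAt i) k i n)
                   (countTrue-cong (enum k (suc i) n) (goodAt-absent i))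
  plain-only : ∀ m r → + count (suc m) r ≡ C r
  plain-only m r = cong +_ (begin
    count (suc m) r                                              ≡⟨ countTrue-extensions-present (goodAt i) k i r m ⟩
    countTrue (λ π → goodAt i ((suc m , false) ∷ π)) E ℕ.+ countTrue (λ π → goodAt i ((suc m , true) ∷ π)) E
                                                                 ≡⟨ cong₂ ℕ._+_ (countTrue-cong E (goodAt-plain i m))
                                                                                (countTrue-none E (goodAt-overlined i m)) ⟩
    countTrue (goodAt (suc i)) E ℕ.+ 0                           ≡⟨ ℕP.+-identityʳ _ ⟩
    countTrue (goodAt (suc i)) E                                 ∎)
    where E = enum k (suc i) r

allSeries-suc : ∀ k i → allSeries (suc k) i ≈ (oddFactor i *ₚ allSeries k (suc i))
allSeries-suc k i = begin
  allSeries (suc k) i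
    ≈⟨ solve 2 (λ S H → S := S :+ H :- H) ≈-refl (allSeries (suc k) i) (A +ₚ A) ⟩
  (allSeries (suc k) i +ₚ (A +ₚ A)) -ₚ (A +ₚ A)      ≈⟨ +-cong (allSeries-suc-+ k i) ≈-refl ⟩
  ((G *ₚ (A +ₚ A)) +ₚ A) -ₚ (A +ₚ A)                 ≈⟨ +-cong (+-cong (geomOdd-*-unfold i (A +ₚ A)) ≈-refl) ≈-refl ⟩
  (((A +ₚ A) +ₚ (X *ₚ (G *ₚ (A +ₚ A)))) +ₚ A) -ₚ (A +ₚ A)
    ≈⟨ solve 3 (λ X G A → ((A :+ A) :+ X :* (G :* (A :+ A)) :+ A) :- (A :+ A) := A :+ X :* ((G :+ G) :* A))
               ≈-refl X G A ⟩
  A +ₚ (X *ₚ ((G +ₚ G) *ₚ A))                        ≈⟨ oddFactor-* i A ⟨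
  oddFactor i *ₚ A                                   ∎
  where
  open ≈-Reasoning
  A = allSeries k (suc i)
  G = geomOdd i
  X = qOdd i

goodSeries-suc : ∀ k i → goodSeries (suc k) i ≈ (allSeries k (suc i) +ₚ ((qOdd i *ₚ geomOdd i) *ₚ goodSeries k (suc i)))
goodSeries-suc k i = begin
  goodSeries (suc k) i                               ≈⟨ solve 2 (λ S H → S := S :+ H :- H) ≈-refl (goodSeries (suc k) i) C ⟩
  (goodSeries (suc k) i +ₚ C) -ₚ C                   ≈⟨ +-cong (goodSeries-suc-+ k i) ≈-refl ⟩
  ((G *ₚ C) +ₚ A) -ₚ C                               ≈⟨ +-cong (+-cong (geomOdd-*-unfold i C) ≈-refl) ≈-refl ⟩
  ((C +ₚ (X *ₚ (G *ₚ C))) +ₚ A) -ₚ C                 ≈⟨ solve 4 (λ X G A C → ((C :+ X :* (G :* C)) :+ A) :- C := A :+ (X :* G) :* C)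
                                                               ≈-refl X G A C ⟩
  A +ₚ ((X *ₚ G) *ₚ C)                               ∎
  where
  open ≈-Reasoning
  A = allSeries k (suc i)
  C = goodSeries k (suc i)
  G = geomOdd i
  X = qOdd i

-- Closed forms

oddFactorProduct : ℕ → ℕ → PS
oddFactorProduct k i = finProd k (λ j → oddFactor (i ℕ.+ j))

yProduct : ℕ → ℕ → PS
yProduct i t = finProd t (λ j → yFactor (i ℕ.+ j))

yTerm : ℕ → ℕ → PS
yTerm i zero    = zeroₚ
yTerm i (suc t) = yProduct i (suc t)

-- ySum k i = Σ_{1 ≤ t ≤ k} yProduct i t
ySum : ℕ → ℕ → PS
ySum k i n = sumUpTo k (λ t → yTerm i t n)

*-sumUpTo-series : ∀ k f (G : ℕ → PS) n → (f *ₚ (λ m → sumUpTo k (λ t → G t m))) n ≡ sumUpTo k (λ t → (f *ₚ G t) n)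
*-sumUpTo-series k f G n =
  trans (sumUpTo-cong n (λ i → *-sumUpTo k (f i) (λ t → G t (n ∸ i))))
        (sumUpTo-swap n k (λ i t → f i * G t (n ∸ i)))

ySum-suc : ∀ k i → ySum (suc k) i ≈ (yFactor i +ₚ (yFactor i *ₚ ySum k (suc i)))
ySum-suc k i n = begin
  ySum (suc k) i n                                              ≡⟨ sumUpTo-head k (λ t → yTerm i t n) ⟩
  + 0 + sumUpTo k (λ t → yProduct i (suc t) n)                  ≡⟨ ℤP.+-identityˡ _ ⟩
  sumUpTo k (λ t → yProduct i (suc t) n)                        ≡⟨ sumUpTo-cong k (λ t → finProd-from t yFactor i n) ⟩
  sumUpTo k (λ t → (Y *ₚ yProduct (suc i) t) n)                 ≡⟨ *-sumUpTo-series k Y (yProduct (suc i)) n ⟨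
  (Y *ₚ P) n                                                    ≡⟨ *-congʳ Y P≈1+W n ⟩
  (Y *ₚ (oneₚ +ₚ W)) n
    ≡⟨ solve 3 (λ Y O W → Y :* (O :+ W) := Y :* O :+ Y :* W) ≈-refl Y oneₚ W n ⟩
  (Y *ₚ oneₚ) n + (Y *ₚ W) n                                    ≡⟨ cong (_+ (Y *ₚ W) n) (*-identityʳ Y n) ⟩
  Y n + (Y *ₚ W) n                                              ∎
  where
  open ≡-Reasoning
  Y = yFactor i
  W = ySum k (suc i)
  P : PS
  P m = sumUpTo k (λ t → yProduct (suc i) t m)
  P≈1+W : P ≈ (oneₚ +ₚ W)
  P≈1+W m = trans (sym (ℤP.+-identityʳ (P m)))
    (trans (sumUpTo-exchange-head k (λ t → yProduct (suc i) t m) (λ t → yTerm (suc i) t m) (λ _ → refl))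
           (ℤP.+-comm (W m) (oneₚ m)))

allSeries-≈ : ∀ k i → allSeries k i ≈ oddFactorProduct k i
allSeries-≈ zero    i = allSeries-zero i
allSeries-≈ (suc k) i = ≈-trans (allSeries-suc k i)
  (≈-trans (*-congʳ (oddFactor i) (allSeries-≈ k (suc i))) (≈-sym (finProd-from k oddFactor i)))

goodSeries-≈ : ∀ k i → goodSeries k i ≈ (oddFactorProduct k i -ₚ (oddFactorProduct k i *ₚ ySum k i))
goodSeries-≈ zero    i n = begin
  goodSeries 0 i n                          ≡⟨ goodSeries-zero i n ⟩
  oneₚ n                                    ≡⟨ ℤP.+-identityʳ (oneₚ n) ⟨
  oneₚ n - + 0                              ≡⟨ cong (λ x → oneₚ n - x) (*-identityˡ (ySum 0 i) n) ⟨
  oneₚ n - (oneₚ *ₚ ySum 0 i) n             ∎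
  where open ≡-Reasoning
goodSeries-≈ (suc k) i = begin
  goodSeries (suc k) i                                       ≈⟨ goodSeries-suc k i ⟩
  allSeries k (suc i) +ₚ ((X *ₚ G) *ₚ goodSeries k (suc i))
    ≈⟨ +-cong (allSeries-≈ k (suc i)) (*-congʳ (X *ₚ G) (goodSeries-≈ k (suc i))) ⟩
  E +ₚ ((X *ₚ G) *ₚ (E -ₚ (E *ₚ W)))
    ≈⟨ solve 4 (λ X G E W → E :+ (X :* G) :* (E :- E :* W) := (E :+ X :* ((G :+ G) :* E)) :- (X :* G) :* (E :+ E :* W))
               ≈-refl X G E W ⟩
  (E +ₚ (X *ₚ ((G +ₚ G) *ₚ E))) -ₚ ((X *ₚ G) *ₚ (E +ₚ (E *ₚ W)))
    ≈⟨ +-cong (oddFactor-* i E) (neg-cong (*-congˡ (E +ₚ (E *ₚ W)) (oddFactor-*-yFactor i))) ⟨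
  (Fi *ₚ E) -ₚ ((Fi *ₚ Y) *ₚ (E +ₚ (E *ₚ W)))
    ≈⟨ solve 4 (λ F E Y W → F :* E :- (F :* Y) :* (E :+ E :* W) := F :* E :- (F :* E) :* (Y :+ Y :* W))
               ≈-refl Fi E Y W ⟩
  (Fi *ₚ E) -ₚ ((Fi *ₚ E) *ₚ (Y +ₚ (Y *ₚ W)))
    ≈⟨ +-cong (finProd-from k oddFactor i) (neg-cong (*-cong (finProd-from k oddFactor i) (ySum-suc k i))) ⟨
  oddFactorProduct (suc k) i -ₚ (oddFactorProduct (suc k) i *ₚ ySum (suc k) i)  ∎
  where
  open ≈-Reasoning
  E = oddFactorProduct k (suc i)
  W = ySum k (suc i)
  Fi = oddFactor i
  Y = yFactor i
  G = geomOdd i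
  X = qOdd i

finProd-oddFactor-truncate : ∀ {m} t → m < t → finProd t oddFactor m ≡ finProd (suc m) oddFactor m
finProd-oddFactor-truncate {m} (suc t) (s≤s m≤t) with m ℕP.≟ t
... | yes refl = refl
... | no  m≢t  = trans (*-oddFactor-low (finProd t oddFactor) t (s≤s (ℕP.≤-trans m≤t (ℕP.m≤m+n t (t ℕ.+ 0)))))
                       (finProd-oddFactor-truncate t (ℕP.≤∧≢⇒< m≤t m≢t))

Pbar-coefficient : ∀ {m n} → m ≤ n → Pbar m ≡ oddFactorProduct (suc n) 0 m
Pbar-coefficient m≤n = sym (finProd-oddFactor-truncate _ (s≤s m≤n))

negOnePow-*-self-cancel : ∀ t x → negOnePow (t ℕ.* t) * (negOnePow t * x) ≡ x
negOnePow-*-self-cancel t x = begin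
  negOnePow (t ℕ.* t) * (negOnePow t * x)   ≡⟨ ℤP.*-assoc (negOnePow (t ℕ.* t)) (negOnePow t) x ⟨
  negOnePow (t ℕ.* t) * negOnePow t * x     ≡⟨ cong (λ a → a * negOnePow t * x) (negOnePow-*-self t) ⟩
  negOnePow t * negOnePow t * x             ≡⟨ cong (_* x) (negOnePow-square t) ⟩
  + 1 * x                                   ≡⟨ ℤP.*-identityˡ x ⟩
  x                                         ∎
  where open ≡-Reasoning

negArg-Fterm : ∀ t → negArg (Fterm t) ≈ yProduct 0 t
negArg-Fterm t = begin
  negArg (shift (t ℕ.* t) (scale c P))                           ≈⟨ negArg-shift (t ℕ.* t) (scale c P) ⟩
  scale c′ (shift (t ℕ.* t) (negArg (scale c P)))                ≈⟨ scale-cong (shift-cong (t ℕ.* t) (negArg-scale c P)) ⟩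
  scale c′ (shift (t ℕ.* t) (scale c (negArg P)))                ≈⟨ scale-cong (shift-scale (t ℕ.* t) c (negArg P)) ⟩
  scale c′ (scale c (shift (t ℕ.* t) (negArg P)))                ≈⟨ sign-cancels ⟩
  shift (t ℕ.* t) (negArg P)                                     ≈⟨ monomial-* (t ℕ.* t) (negArg P) ⟨
  monomial (t ℕ.* t) *ₚ negArg P                                 ≈⟨ *-cong (monomial-square t) (negArg-finProd t geomOdd) ⟩
  finProd t qOdd *ₚ finProd t (negArg ∘ geomOdd)                 ≈⟨ finProd-* t qOdd (negArg ∘ geomOdd) ⟩
  yProduct 0 t                                                   ∎
  where
  open ≈-Reasoning
  P = invPochOdd t
  c = negOnePow t
  c′ = negOnePow (t ℕ.* t)
  scale-cong : ∀ {f g} → f ≈ g → scale c′ f ≈ scale c′ g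
  scale-cong f≈g n = cong (c′ *_) (f≈g n)
  sign-cancels : scale c′ (scale c (shift (t ℕ.* t) (negArg P))) ≈ shift (t ℕ.* t) (negArg P)
  sign-cancels n = negOnePow-*-self-cancel t (shift (t ℕ.* t) (negArg P) n)

negArg-F-coefficient : ∀ {m n} → m ≤ n → negArg F m ≡ ySum (suc n) 0 m
negArg-F-coefficient {m} {n} m≤n = begin
  negOnePow m * sumUpTo m (λ t → if t ≡ᵇ 0 then + 0 else Fterm t m)
    ≡⟨ *-sumUpTo m (negOnePow m) _ ⟩
  sumUpTo m (λ t → negOnePow m * (if t ≡ᵇ 0 then + 0 else Fterm t m))
    ≡⟨ sumUpTo-cong m term ⟩
  sumUpTo m (λ t → yTerm 0 t m)
    ≡⟨ sumUpTo-truncate (suc n) (λ t → yTerm 0 t m) (ℕP.m≤n⇒m≤1+n m≤n) vanish ⟨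
  ySum (suc n) 0 m ∎
  where
  open ≡-Reasoning
  term : ∀ t → negOnePow m * (if t ≡ᵇ 0 then + 0 else Fterm t m) ≡ yTerm 0 t m
  term zero    = ℤP.*-zeroʳ (negOnePow m)
  term (suc t) = negArg-Fterm (suc t) m
  -- Fterm t is a multiple of q^(t²)
  vanish : ∀ t → m < t → yTerm 0 t m ≡ + 0
  vanish (suc t) m<1+t = begin
    yTerm 0 (suc t) m                          ≡⟨ term (suc t) ⟨
    negOnePow m * Fterm (suc t) m
      ≡⟨ cong (negOnePow m *_) (shift-< (scale (negOnePow (suc t)) (invPochOdd (suc t))) m<[1+t]²) ⟩
    negOnePow m * + 0                          ≡⟨ ℤP.*-zeroʳ (negOnePow m) ⟩
    + 0                                        ∎
    where m<[1+t]² = ℕP.<-≤-trans m<1+t (ℕP.m≤m*n (suc t) (suc t))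

*-coefficient-cong : ∀ n {f f′ g g′} → (∀ i → i ≤ n → f i ≡ f′ i) → (∀ i → i ≤ n → g i ≡ g′ i) →
  (f *ₚ g) n ≡ (f′ *ₚ g′) n
*-coefficient-cong n f≡f′ g≡g′ = sumUpTo-cong≤ n (λ i i≤n → cong₂ _*_ (f≡f′ i i≤n) (g≡g′ (n ∸ i) (ℕP.m∸n≤m n i)))

theorem2p2 : (n : ℕ) → Mbar n ≡ (Pbar *ₚ (oneₚ +ₚ (-ₚ negArg F))) n
theorem2p2 n = begin
  Mbar n                                       ≡⟨⟩
  goodSeries (suc n) 0 n                       ≡⟨ goodSeries-≈ (suc n) 0 n ⟩
  (E -ₚ (E *ₚ W)) n                            ≡⟨ cong (λ x → x - (E *ₚ W) n) (*-identityʳ E n) ⟨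
  ((E *ₚ oneₚ) -ₚ (E *ₚ W)) n                  ≡⟨ solve 3 (λ E O W → E :* O :- E :* W := E :* (O :- W)) ≈-refl E oneₚ W n ⟩
  (E *ₚ (oneₚ -ₚ W)) n                         ≡⟨ *-coefficient-cong n (λ i i≤n → sym (Pbar-coefficient i≤n))
                                                    (λ i i≤n → cong (λ x → oneₚ i - x) (sym (negArg-F-coefficient i≤n))) ⟩
  (Pbar *ₚ (oneₚ +ₚ (-ₚ negArg F))) n          ∎
  where
  open ≡-Reasoning
  E = oddFactorProduct (suc n) 0
  W = ySum (suc n) 0
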